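{- Let $(A,\wedge,\vee,\cdot,\rightarrow,e)$ be an srl-monoid and $a,b,c\in A$. Then: 1) if $a\leq b\rightarrow c$ then $a\cdot b\leq c$; 2) if $a\cdot b \leq c$ then $\square(a) \leq b\rightarrow c$, where $\square(a)=e\rightarrow a$.
   Context: A commutative l-monoid is an algebra $(A,\wedge,\vee,\cdot,e)$ of type $(2,2,2,0)$ such that $(A,\wedge,\vee)$ is a lattice, $(A,\cdot,e)$ is a commutative monoid and $(a\vee b)\cdot c=(a\cdot c)\vee(b\cdot c)$ for all $a,b,c\in A$. An algebra $(A,\wedge,\vee,\cdot,\rightarrow,e)$ of type $(2,2,2,2,0)$ is an srl-monoid if $(A,\wedge,\vee,\cdot,e)$ is a commutative l-monoid and there is a subalgebra $Q$ of $(A,\wedge,\vee,\cdot,e)$ such that for all $a,b\in A$ the set $\{q\in Q: a\cdot q\leq b\}$ has a maximum and $a\rightarrow b$ equals this maximum. -}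

module Defs where

open import Level using (Level; _⊔_; suc)
open import Relation.Binary.PropositionalEquality using (_≡_)
open import Algebra.Core using (Op₂)
open import Algebra.Lattice.Structures using (IsLattice)
open import Algebra.Structures using (IsCommutativeMonoid)

record IsCommLMonoid {a} {A : Set a} (_∧_ _∨_ _·_ : Op₂ A) (e : A) : Set a where
  field
    isLattice           : IsLattice _≡_ _∨_ _∧_
    isCommutativeMonoid : IsCommutativeMonoid _≡_ _·_ e
    ∨-distrib-·         : ∀ x y z → ((x ∨ y) · z) ≡ ((x · z) ∨ (y · z))

LatticeLeq : ∀ {a} {A : Set a} → Op₂ A → A → A → Set a
LatticeLeq _∧_ x y = (x ∧ y) ≡ x

record IsSubalgebra {a q} {A : Set a} (_∧_ _∨_ _·_ : Op₂ A) (e : A) (Q : A → Set q)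
       : Set (a ⊔ q) where
  field
    ∧-closed : ∀ {x y} → Q x → Q y → Q (x ∧ y)
    ∨-closed : ∀ {x y} → Q x → Q y → Q (x ∨ y)
    ·-closed : ∀ {x y} → Q x → Q y → Q (x · y)
    e-in     : Q e

IsMaximumResidual : ∀ {a q} {A : Set a} (_∧_ _·_ : Op₂ A) (Q : A → Set q)
                    (x y m : A) → Set (a ⊔ q)
IsMaximumResidual _∧_ _·_ Q x y m =
  (Q m × LatticeLeq _∧_ (x · m) y) ×
  (∀ z → Q z → LatticeLeq _∧_ (x · z) y → LatticeLeq _∧_ z m)
  where open import Data.Product using (_×_)

record SrlMonoid (a q : Level) : Set (suc (a ⊔ q)) where
  infixr 6 _∨_
  infixr 7 _∧_
  infixr 8 _·_
  infixr 5 _⇒_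
  field
    Carrier       : Set a
    _∧_ _∨_ _·_ _⇒_ : Op₂ Carrier
    e             : Carrier
    isCommLMonoid : IsCommLMonoid _∧_ _∨_ _·_ e
    Q             : Carrier → Set q
    isSubalgebra  : IsSubalgebra _∧_ _∨_ _·_ e Q
    ⇒-isMax       : ∀ x y → IsMaximumResidual _∧_ _·_ Q x y (x ⇒ y)

  _≤_ : Carrier → Carrier → Set a
  _≤_ = LatticeLeq _∧_

  □ : Carrier → Carrier
  □ x = e ⇒ x

{-# OPTIONS --safe #-}
module Submission where

open import Defs
open import Level using (Level)
open import Algebra.Core using (Op₂)
open import Algebra.Lattice.Structures using (IsLattice)
open import Algebra.Structures using (IsCommutativeMonoid)
open import Data.Product using (_×_; _,_; proj₁; proj₂)
open import Relation.Binary.PropositionalEquality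
  using (_≡_; sym; cong; subst; module ≡-Reasoning)

-- Only half of residuation holds, because x ⇒ y dominates just the elements of Q
-- with x · q ≤ y. For 1) multiply a ≤ b ⇒ c by b and use (b ⇒ c) · b ≤ c.
-- For 2) a itself need not lie in Q, but □ a does and □ a ≤ a,
-- so b · □ a ≤ a · b ≤ c.

module LatticeOrder {a} {A : Set a} {_∧_ _∨_ : Op₂ A}
                    (isLattice : IsLattice _≡_ _∨_ _∧_) where
  open IsLattice isLattice using (∧-comm; ∧-assoc; ∨-comm; ∨-absorbs-∧; ∧-absorbs-∨)
  open ≡-Reasoning

  _≤_ : A → A → Set a
  _≤_ = LatticeLeq _∧_

  ≤-trans : ∀ {x y z} → x ≤ y → y ≤ z → x ≤ z
  ≤-trans {x} {y} {z} x≤y y≤z = begin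
    x ∧ z        ≡⟨ cong (_∧ z) (sym x≤y) ⟩
    (x ∧ y) ∧ z  ≡⟨ ∧-assoc x y z ⟩
    x ∧ (y ∧ z)  ≡⟨ cong (x ∧_) y≤z ⟩
    x ∧ y        ≡⟨ x≤y ⟩
    x            ∎

  ≤⇒∨≡ : ∀ {x y} → x ≤ y → x ∨ y ≡ y
  ≤⇒∨≡ {x} {y} x≤y = begin
    x ∨ y        ≡⟨ cong (_∨ y) (sym x≤y) ⟩
    (x ∧ y) ∨ y  ≡⟨ ∨-comm (x ∧ y) y ⟩
    y ∨ (x ∧ y)  ≡⟨ cong (y ∨_) (∧-comm x y) ⟩
    y ∨ (y ∧ x)  ≡⟨ ∨-absorbs-∧ y x ⟩
    y            ∎

  ∨≡⇒≤ : ∀ {x y} → x ∨ y ≡ y → x ≤ y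
  ∨≡⇒≤ {x} {y} x∨y≡y = begin
    x ∧ y        ≡⟨ cong (x ∧_) (sym x∨y≡y) ⟩
    x ∧ (x ∨ y)  ≡⟨ ∧-absorbs-∨ x y ⟩
    x            ∎

module CommLMonoidProperties {a} {A : Set a} {_∧_ _∨_ _·_ : Op₂ A} {e : A}
                             (isCommLMonoid : IsCommLMonoid _∧_ _∨_ _·_ e) where
  open IsCommLMonoid isCommLMonoid using (isLattice; ∨-distrib-·)
  open LatticeOrder isLattice public
  open ≡-Reasoning

  ·-monoˡ-≤ : ∀ {x y} z → x ≤ y → (x · z) ≤ (y · z)
  ·-monoˡ-≤ {x} {y} z x≤y = ∨≡⇒≤ (begin
    (x · z) ∨ (y · z)  ≡⟨ sym (∨-distrib-· x y z) ⟩
    (x ∨ y) · z        ≡⟨ cong (_· z) (≤⇒∨≡ x≤y) ⟩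
    y · z              ∎)

module SrlMonoidProperties {ℓa ℓq : Level} (S : SrlMonoid ℓa ℓq) where
  open SrlMonoid S
  open IsCommLMonoid isCommLMonoid using (isCommutativeMonoid)
  open IsCommutativeMonoid isCommutativeMonoid using (comm; identityʳ)
  open CommLMonoidProperties isCommLMonoid using (≤-trans; ·-monoˡ-≤)

  ⇒-in-Q : ∀ x y → Q (x ⇒ y)
  ⇒-in-Q x y = proj₁ (proj₁ (⇒-isMax x y))

  ⇒-counit : ∀ x y → ((x ⇒ y) · x) ≤ y
  ⇒-counit x y = subst (_≤ y) (comm x (x ⇒ y)) (proj₂ (proj₁ (⇒-isMax x y)))

  ⇒-greatest : ∀ {x y z} → Q z → (x · z) ≤ y → z ≤ (x ⇒ y)
  ⇒-greatest {x} {y} {z} = proj₂ (⇒-isMax x y) z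

  ≤⇒-⇒-·≤ : ∀ {x y z} → x ≤ (y ⇒ z) → (x · y) ≤ z
  ≤⇒-⇒-·≤ {x} {y} {z} x≤y⇒z = ≤-trans (·-monoˡ-≤ y x≤y⇒z) (⇒-counit y z)

  □-deflationary : ∀ x → □ x ≤ x
  □-deflationary x = subst (_≤ x) (identityʳ (□ x)) (⇒-counit e x)

  ·≤-⇒-□≤⇒ : ∀ {x y z} → (x · y) ≤ z → □ x ≤ (y ⇒ z)
  ·≤-⇒-□≤⇒ {x} {y} {z} x·y≤z = ⇒-greatest (⇒-in-Q e x) y·□x≤z
    where
    y·□x≤z : (y · □ x) ≤ z
    y·□x≤z = subst (_≤ z) (comm (□ x) y)
               (≤-trans (·-monoˡ-≤ y (□-deflationary x)) x·y≤z)

proposition2p9 : ∀ {ℓa ℓq : Level} (S : SrlMonoid ℓa ℓq) →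
    let open SrlMonoid S in
    ∀ (a b c : Carrier) →
    ((a ≤ (b ⇒ c)) → ((a · b) ≤ c)) ×
    (((a · b) ≤ c) → (□ a ≤ (b ⇒ c)))
proposition2p9 S a b c = ≤⇒-⇒-·≤ , ·≤-⇒-□≤⇒
  where open SrlMonoidProperties S
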